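{- Let $k\ge 1$ and $s\ge 2$ be integers, let $X$ be a set with $|X|=ks$, and let $a$ be a $k$-element subset of $X$. Then the neighborhood of $a$ in $\mathbf{CR}(X,k,s)$ is exactly $\mathbf{CR}(X\setminus a,k,s-1)$; that is, the set of points lying on blocks through $a$, other than $a$ itself, is the set of $k$-element subsets of $X\setminus a$, and the sets $B\setminus\{a\}$, for $B$ a block through $a$, are exactly the blocks of $\mathbf{CR}(X\setminus a,k,s-1)$.
   Context: For a finite set $Y$ and positive integers $k,s$ with $|Y|=ks+m$, $m\ge 0$, the generalized Cremona–Richmond configuration $\mathbf{CR}(Y,k,s)$ is the incidence structure whose points are the $(k+m)$-element subsets of $Y$ and whose blocks are the sets $\{a_1\cup p,\dots,a_s\cup p\}$, where $a_1,\dots,a_s$ are pairwise disjoint $k$-element subsets of $Y$ and $p$ is an $m$-element subset of $Y$ disjoint from every $a_i$. (When $|Y|=ks$, i.e. $m=0$, the points are the $k$-subsets of $Y$ and the blocks are the partitions of $Y$ into $s$ sets of size $k$.) Incidence is membership. The neighborhood of a point $a$ is the substructure whose points are the points on blocks through $a$ with $a$ deleted, and whose blocks are the blocks through $a$ (with $a$ removed from them). -}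

module Defs where

open import Level using (0ℓ)
open import Data.Nat using (ℕ; _+_; _*_; _∸_)
open import Data.Fin using (Fin)
open import Data.Fin.Subset using (Subset; _⊆_; _∩_; _∪_; ∣_∣; ⊥)
open import Data.Product using (Σ; ∃; _×_)
open import Function.Bundles using (_⇔_)
open import Relation.Binary.PropositionalEquality using (_≡_; _≢_)

-- The ground set Y of a configuration is a finite set, represented as a
-- subset Y of Fin N.  Points and blocks of CR(Y,k,s) are subsets of Fin N
-- contained in Y, resp. (extensionally given) sets of such points.

PointSet : ℕ → Set₁
PointSet N = Subset N → Set

Disjoint : ∀ {N} → Subset N → Subset N → Set
Disjoint p q = p ∩ q ≡ ⊥

excess : ∀ {N} → Subset N → ℕ → ℕ → ℕ
excess Y k s = ∣ Y ∣ ∸ (k * s)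

IsPoint : ∀ {N} → Subset N → ℕ → ℕ → Subset N → Set
IsPoint Y k s q = (q ⊆ Y) × (∣ q ∣ ≡ k + excess Y k s)

IsBlock : ∀ {N} → Subset N → ℕ → ℕ → PointSet N → Set
IsBlock {N} Y k s B =
  Σ (Fin s → Subset N) λ as → Σ (Subset N) λ p →
    ((i : Fin s) → (as i ⊆ Y) × (∣ as i ∣ ≡ k))
    × ((i j : Fin s) → i ≢ j → Disjoint (as i) (as j))
    × (p ⊆ Y) × (∣ p ∣ ≡ excess Y k s)
    × ((i : Fin s) → Disjoint p (as i))
    × ((q : Subset N) → B q ⇔ ∃ λ (i : Fin s) → q ≡ as i ∪ p)

module Submission where

-- Since |X| = k s the padding set p of every block is empty (its size is the
-- excess |X| - k s = 0), so a block of CR(X,k,s) is just the set of parts of a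
-- partition of X into s pairwise disjoint k-subsets.  Removing and
-- adding the part a are mutually inverse, which identifies the blocks through
-- a (with a deleted) with the blocks of CR(X ─ a, k, s-1).  The statement about
-- points follows formally: the points of the neighbourhood are the points on
-- its blocks, and every point of CR(X ─ a, k, s-1) lies on one of its blocks.

open import Defs
open import Data.Nat using (ℕ; _*_; _∸_; _≤_)
open import Data.Fin.Subset using (Subset; _─_; ∣_∣)
open import Data.Product using (Σ; _×_)
open import Function.Bundles using (_⇔_)
open import Relation.Binary.PropositionalEquality using (_≡_; _≢_)

open import Data.Nat using (zero; suc; _+_; z≤n; s≤s)
open import Data.Nat.Properties using (+-cancelʳ-≡; +-comm; +-suc; n∸n≡0; +-identityʳ; m≤m+n; *-suc)
open import Data.Fin using (Fin; zero; suc; punchIn; punchOut)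
open import Data.Fin.Properties using (punchIn-injective; punchInᵢ≢i; punchIn-punchOut)
open import Data.Fin.Subset using (_∈_; _∉_; _⊆_; _∩_; _∪_; ⊥)
open import Data.Fin.Subset.Properties
  using (∉⊥; ⊥⊆; ∣⊥∣≡0; Empty-unique; x∈p∩q⁺; x∈p∩q⁻; p─q⊆p; x∈p∧x∉q⇒x∈p─q;
         ∩-comm; ∩-idem; ∩-zeroˡ; ∪-identityʳ; s⊆s; out⊆; drop-∷-⊆)
open import Data.Vec using ([]; _∷_; here; there)
open import Data.Vec.Functional using (removeAt) renaming (_∷_ to _◂_)
open import Data.Product using (_,_; ∃; proj₁; proj₂)
open import Data.Product.Function.NonDependent.Propositional using (_×-⇔_)
open import Data.Bool using (true; false)
open import Data.Empty using (⊥-elim)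
open import Relation.Binary.PropositionalEquality using (refl; sym; trans; cong; subst; module ≡-Reasoning)
open import Function.Bundles using (mk⇔; Equivalence)
open import Function.Properties.Equivalence using () renaming (refl to ⇔-refl; sym to ⇔-sym; trans to ⇔-trans)

open Equivalence using (to; from)

∣p∣≡0⇒p≡⊥ : ∀ {n} (p : Subset n) → ∣ p ∣ ≡ 0 → p ≡ ⊥
∣p∣≡0⇒p≡⊥ []          _  = refl
∣p∣≡0⇒p≡⊥ (true ∷ p)  ()
∣p∣≡0⇒p≡⊥ (false ∷ p) e  = cong (false ∷_) (∣p∣≡0⇒p≡⊥ p e)

∣p─q∣+∣q∣≡∣p∣ : ∀ {n} (p q : Subset n) → q ⊆ p → ∣ p ─ q ∣ + ∣ q ∣ ≡ ∣ p ∣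
∣p─q∣+∣q∣≡∣p∣ []          []          _ = refl
∣p─q∣+∣q∣≡∣p∣ (true ∷ p)  (true ∷ q)  q⊆p =
  trans (+-suc ∣ p ─ q ∣ ∣ q ∣) (cong suc (∣p─q∣+∣q∣≡∣p∣ p q (drop-∷-⊆ q⊆p)))
∣p─q∣+∣q∣≡∣p∣ (false ∷ p) (true ∷ q)  q⊆p with q⊆p here
... | ()
∣p─q∣+∣q∣≡∣p∣ (true ∷ p)  (false ∷ q) q⊆p = cong suc (∣p─q∣+∣q∣≡∣p∣ p q (drop-∷-⊆ q⊆p))
∣p─q∣+∣q∣≡∣p∣ (false ∷ p) (false ∷ q) q⊆p = ∣p─q∣+∣q∣≡∣p∣ p q (drop-∷-⊆ q⊆p)

subset-of-size : ∀ {n} (p : Subset n) (k : ℕ) → k ≤ ∣ p ∣ →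
                 Σ (Subset n) λ q → (q ⊆ p) × (∣ q ∣ ≡ k)
subset-of-size {n} p           zero    _       = ⊥ , ⊥⊆ , ∣⊥∣≡0 n
subset-of-size (true ∷ p)  (suc k) (s≤s k≤∣p∣) with subset-of-size p k k≤∣p∣
... | q , q⊆p , ∣q∣ = true ∷ q , s⊆s q⊆p , cong suc ∣q∣
subset-of-size (false ∷ p) (suc k) k≤∣p∣ with subset-of-size p (suc k) k≤∣p∣
... | q , q⊆p , ∣q∣ = false ∷ q , out⊆ q⊆p , ∣q∣

size-of-rest : ∀ {n k t} {Y c : Subset n} → c ⊆ Y → ∣ c ∣ ≡ k → ∣ Y ∣ ≡ k * suc t →
               ∣ Y ─ c ∣ ≡ k * t
size-of-rest {k = k} {t} {Y} {c} c⊆Y ∣c∣ ∣Y∣ = +-cancelʳ-≡ k ∣ Y ─ c ∣ (k * t) (begin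
  ∣ Y ─ c ∣ + k      ≡⟨ cong (∣ Y ─ c ∣ +_) ∣c∣ ⟨
  ∣ Y ─ c ∣ + ∣ c ∣  ≡⟨ ∣p─q∣+∣q∣≡∣p∣ Y c c⊆Y ⟩
  ∣ Y ∣              ≡⟨ trans ∣Y∣ (*-suc k t) ⟩
  k + k * t          ≡⟨ +-comm k (k * t) ⟩
  k * t + k          ∎)
  where open ≡-Reasoning

disjoint⇒∉ : ∀ {n} {p q : Subset n} {x : Fin n} → Disjoint p q → x ∈ p → x ∉ q
disjoint⇒∉ {x = x} p∩q≡⊥ x∈p x∈q = ∉⊥ (subst (x ∈_) p∩q≡⊥ (x∈p∩q⁺ (x∈p , x∈q)))

∉⇒disjoint : ∀ {n} {p q : Subset n} → (∀ {x} → x ∈ p → x ∉ q) → Disjoint p q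
∉⇒disjoint {p = p} {q} apart =
  Empty-unique λ { (x , x∈p∩q) → let (x∈p , x∈q) = x∈p∩q⁻ p q x∈p∩q in apart x∈p x∈q }

x∈p─q⇒x∉q : ∀ {n} (p q : Subset n) {x : Fin n} → x ∈ p ─ q → x ∉ q
x∈p─q⇒x∉q (_ ∷ p) (_ ∷ q)    (there x∈p─q) (there x∈q) = x∈p─q⇒x∉q p q x∈p─q x∈q
x∈p─q⇒x∉q (_ ∷ p) (true ∷ q) ()            here

⊆─⇔ : ∀ {n} {q Y a : Subset n} → (q ⊆ Y ─ a) ⇔ ((q ⊆ Y) × Disjoint q a)
⊆─⇔ {Y = Y} {a} = mk⇔
  (λ q⊆Y─a → (λ {x} x∈q → p─q⊆p Y a (q⊆Y─a x∈q))
           , ∉⇒disjoint (λ {x} x∈q → x∈p─q⇒x∉q Y a (q⊆Y─a x∈q)))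
  (λ (q⊆Y , q∩a≡⊥) {x} x∈q → x∈p∧x∉q⇒x∈p─q (q⊆Y x∈q) (disjoint⇒∉ q∩a≡⊥ x∈q))

nonempty-disjoint⇒≢ : ∀ {n k} {p q : Subset n} → ∣ p ∣ ≡ suc k → Disjoint p q → p ≢ q
nonempty-disjoint⇒≢ {n} {k} {p} ∣p∣ p∩p≡⊥ refl with begin
    suc k      ≡⟨ ∣p∣ ⟨
    ∣ p ∣      ≡⟨ cong ∣_∣ (∩-idem p) ⟨
    ∣ p ∩ p ∣  ≡⟨ cong ∣_∣ p∩p≡⊥ ⟩
    ∣ ⊥ {n} ∣  ≡⟨ ∣⊥∣≡0 n ⟩
    0          ∎
  where open ≡-Reasoning
... | ()

IsPartition : ∀ {N} → Subset N → ℕ → (t : ℕ) → (Fin t → Subset N) → Set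
IsPartition Y k t bs = ((i : Fin t) → (bs i ⊆ Y) × (∣ bs i ∣ ≡ k))
                     × ((i j : Fin t) → i ≢ j → Disjoint (bs i) (bs j))

Part : ∀ {N t} → (Fin t → Subset N) → PointSet N
Part bs q = ∃ λ i → q ≡ bs i

PartitionBlock : ∀ {N} → Subset N → ℕ → ℕ → PointSet N → Set
PartitionBlock {N} Y k t B =
  Σ (Fin t → Subset N) λ bs → IsPartition Y k t bs × ((q : Subset N) → B q ⇔ Part bs q)

parts-distinct : ∀ {N k t} {Y : Subset N} {bs : Fin t → Subset N} →
                 IsPartition Y (suc k) t bs → ∀ {i j} → i ≢ j → bs i ≢ bs j
parts-distinct (parts , disjoint) {i} {j} i≢j = nonempty-disjoint⇒≢ (proj₂ (parts i)) (disjoint i j i≢j)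

partition-extend : ∀ {N k t} {Y c : Subset N} {bs : Fin t → Subset N} →
                   c ⊆ Y → ∣ c ∣ ≡ k → IsPartition (Y ─ c) k t bs → IsPartition Y k (suc t) (c ◂ bs)
partition-extend {Y = Y} {c} {bs} c⊆Y ∣c∣ (parts , disjoint) = parts′ , disjoint′
  where
  parts′ : ∀ i → ((c ◂ bs) i ⊆ Y) × (∣ (c ◂ bs) i ∣ ≡ _)
  parts′ zero    = c⊆Y , ∣c∣
  parts′ (suc i) = proj₁ (to ⊆─⇔ (proj₁ (parts i))) , proj₂ (parts i)
  disjoint′ : ∀ i j → i ≢ j → Disjoint ((c ◂ bs) i) ((c ◂ bs) j)
  disjoint′ zero    zero    0≢0 = ⊥-elim (0≢0 refl)
  disjoint′ zero    (suc j) _   = trans (∩-comm c (bs j)) (proj₂ (to ⊆─⇔ (proj₁ (parts j))))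
  disjoint′ (suc i) zero    _   = proj₂ (to ⊆─⇔ (proj₁ (parts i)))
  disjoint′ (suc i) (suc j) i≢j = disjoint i j (λ i≡j → i≢j (cong suc i≡j))

partition-remove : ∀ {N k t} {Y : Subset N} {bs : Fin (suc t) → Subset N} →
                   IsPartition Y k (suc t) bs → ∀ j → IsPartition (Y ─ bs j) k t (removeAt bs j)
partition-remove (parts , disjoint) j =
  (λ i → from ⊆─⇔ (proj₁ (parts (punchIn j i)) , disjoint (punchIn j i) j (punchInᵢ≢i j i))
       , proj₂ (parts (punchIn j i)))
  , λ i i′ i≢i′ → disjoint (punchIn j i) (punchIn j i′) (λ e → i≢i′ (punchIn-injective j i i′ e))

Part-remove : ∀ {N k t} {Y : Subset N} {bs : Fin (suc t) → Subset N} →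
              IsPartition Y (suc k) (suc t) bs → ∀ j q → Part (removeAt bs j) q ⇔ (Part bs q × q ≢ bs j)
Part-remove {bs = bs} P j q = mk⇔
  (λ { (i , refl) → (punchIn j i , refl) , parts-distinct P (punchInᵢ≢i j i) })
  (λ { ((i , refl) , bsᵢ≢bsⱼ) →
         let j≢i : j ≢ i
             j≢i j≡i = bsᵢ≢bsⱼ (cong bs (sym j≡i))
         in punchOut j≢i , cong bs (sym (punchIn-punchOut j≢i)) })

partition-exists : ∀ {N} k t (Y : Subset N) → ∣ Y ∣ ≡ k * t → Σ (Fin t → Subset N) (IsPartition Y k t)
partition-exists k zero    Y _   = (λ ()) , (λ ()) , (λ ())
partition-exists k (suc t) Y ∣Y∣ with subset-of-size Y k (subst (k ≤_) (sym (trans ∣Y∣ (*-suc k t))) (m≤m+n k (k * t)))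
... | c , c⊆Y , ∣c∣ with partition-exists k t (Y ─ c) (size-of-rest c⊆Y ∣c∣ ∣Y∣)
... | bs , P = c ◂ bs , partition-extend c⊆Y ∣c∣ P

Part-pad-⊥ : ∀ {N t} (bs : Fin t → Subset N) (q : Subset N) →
             (∃ λ i → q ≡ bs i ∪ ⊥) ⇔ Part bs q
Part-pad-⊥ bs q = mk⇔ (λ (i , e) → i , trans e (∪-identityʳ (bs i)))
                      (λ (i , e) → i , trans e (sym (∪-identityʳ (bs i))))

excess-zero : ∀ {N} (Y : Subset N) k t → ∣ Y ∣ ≡ k * t → excess Y k t ≡ 0
excess-zero Y k t ∣Y∣ rewrite ∣Y∣ = n∸n≡0 (k * t)

block⇔partitionBlock : ∀ {N k t} {Y : Subset N} {B : PointSet N} →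
                       excess Y k t ≡ 0 → IsBlock Y k t B ⇔ PartitionBlock Y k t B
block⇔partitionBlock {N} {Y = Y} excess≡0 = mk⇔ toPartition fromPartition
  where
  toPartition : ∀ {B} → IsBlock Y _ _ B → PartitionBlock Y _ _ B
  toPartition (as , p , parts , disjoint , _ , ∣p∣ , _ , B⇔) with ∣p∣≡0⇒p≡⊥ p (trans ∣p∣ excess≡0)
  ... | refl = as , (parts , disjoint) , λ q → ⇔-trans (B⇔ q) (Part-pad-⊥ as q)
  fromPartition : ∀ {B} → PartitionBlock Y _ _ B → IsBlock Y _ _ B
  fromPartition (bs , (parts , disjoint) , B⇔) =
    bs , ⊥ , parts , disjoint , ⊥⊆ , trans (∣⊥∣≡0 N) (sym excess≡0) , (λ i → ∩-zeroˡ (bs i))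
    , λ q → ⇔-trans (B⇔ q) (⇔-sym (Part-pad-⊥ bs q))

point⇔k-subset : ∀ {N k t} {Y q : Subset N} →
                 excess Y k t ≡ 0 → IsPoint Y k t q ⇔ ((q ⊆ Y) × (∣ q ∣ ≡ k))
point⇔k-subset {k = k} excess≡0 = ⇔-refl ×-⇔ mk⇔ (λ e → trans e k+0≡k) (λ e → trans e (sym k+0≡k))
  where
  k+0≡k : k + _ ≡ k
  k+0≡k = trans (cong (k +_) excess≡0) (+-identityʳ k)

-- When ∣ Y ∣ = k (t+1), the points of CR(Y,k,t+1) are exactly the sets lying
-- on some block: a point q is completed to a block by a partition of Y ─ q.
on-block⇔point : ∀ {N k t} {Y : Subset N} → ∣ Y ∣ ≡ k * suc t →
                 ∀ q → (Σ (PointSet N) λ C → IsBlock Y k (suc t) C × C q) ⇔ IsPoint Y k (suc t) q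
on-block⇔point {N} {k} {t} {Y} ∣Y∣ q = mk⇔ onBlock⇒point point⇒onBlock
  where
  blocks : ∀ {C} → IsBlock Y k (suc t) C ⇔ PartitionBlock Y k (suc t) C
  blocks = block⇔partitionBlock (excess-zero Y k (suc t) ∣Y∣)
  points : IsPoint Y k (suc t) q ⇔ ((q ⊆ Y) × (∣ q ∣ ≡ k))
  points = point⇔k-subset (excess-zero Y k (suc t) ∣Y∣)
  onBlock⇒point : (Σ (PointSet N) λ C → IsBlock Y k (suc t) C × C q) → IsPoint Y k (suc t) q
  onBlock⇒point (C , block , Cq) with to blocks block
  ... | bs , (parts , _) , C⇔ with to (C⇔ q) Cq
  ... | i , refl = from points (parts i)
  point⇒onBlock : IsPoint Y k (suc t) q → Σ (PointSet N) λ C → IsBlock Y k (suc t) C × C q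
  point⇒onBlock point with to points point
  ... | q⊆Y , ∣q∣ with partition-exists k t (Y ─ q) (size-of-rest q⊆Y ∣q∣ ∣Y∣)
  ... | bs , P = Part (q ◂ bs) , from blocks (q ◂ bs , partition-extend q⊆Y ∣q∣ P , λ _ → ⇔-refl) , (zero , refl)

-- The blocks through a point a of CR(X,k,t+1), with a deleted, are the blocks
-- of CR(X ─ a, k, t): delete the part a, resp. add it back.
neighbourhood-blocks : ∀ {N k t} {X a : Subset N} →
  excess X (suc k) (suc t) ≡ 0 → excess (X ─ a) (suc k) t ≡ 0 → a ⊆ X → ∣ a ∣ ≡ suc k →
  (C : PointSet N) →
  (Σ (PointSet N) λ B → IsBlock X (suc k) (suc t) B × B a × ((q : Subset N) → C q ⇔ (B q × q ≢ a)))
  ⇔ IsBlock (X ─ a) (suc k) t C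
neighbourhood-blocks {N} {k} {t} {X} {a} excessX excessX─a a⊆X ∣a∣ C = mk⇔ deleteA addA
  where
  deleteA : (Σ (PointSet N) λ B → IsBlock X (suc k) (suc t) B × B a × ((q : Subset N) → C q ⇔ (B q × q ≢ a)))
            → IsBlock (X ─ a) (suc k) t C
  deleteA (B , block , Ba , C⇔) with to (block⇔partitionBlock excessX) block
  ... | bs , P , B⇔ with to (B⇔ a) Ba
  ... | j , refl = from (block⇔partitionBlock excessX─a)
    (removeAt bs j , partition-remove P j ,
     λ q → ⇔-trans (C⇔ q) (⇔-trans (B⇔ q ×-⇔ ⇔-refl) (⇔-sym (Part-remove P j q))))
  addA : IsBlock (X ─ a) (suc k) t C
         → Σ (PointSet N) λ B → IsBlock X (suc k) (suc t) B × B a × ((q : Subset N) → C q ⇔ (B q × q ≢ a))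
  addA block with to (block⇔partitionBlock excessX─a) block
  ... | cs , P , C⇔ =
    Part (a ◂ cs) , from (block⇔partitionBlock excessX) (a ◂ cs , P′ , λ _ → ⇔-refl) , (zero , refl) ,
    λ q → ⇔-trans (C⇔ q) (Part-remove P′ zero q)
    where
    P′ = partition-extend a⊆X ∣a∣ P

neighbourhood-points : ∀ {N} {IsBlk IsBlk′ : PointSet N → Set} {a : Subset N} →
  ((C : PointSet N) →
     (Σ (PointSet N) λ B → IsBlk B × B a × ((q : Subset N) → C q ⇔ (B q × q ≢ a))) ⇔ IsBlk′ C) →
  (q : Subset N) →
  (Σ (PointSet N) λ B → IsBlk B × B a × B q × q ≢ a) ⇔ (Σ (PointSet N) λ C → IsBlk′ C × C q)
neighbourhood-points {a = a} blocks q = mk⇔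
  (λ (B , block , Ba , Bq , q≢a) → (λ r → B r × r ≢ a) , to (blocks _) (B , block , Ba , λ _ → ⇔-refl) , Bq , q≢a)
  (λ (C , block′ , Cq) → let (B , block , Ba , C⇔) = from (blocks C) block′
                         in B , block , Ba , to (C⇔ q) Cq)

fact1p1 : (N k s : ℕ) → 1 ≤ k → 2 ≤ s →
          (X : Subset N) → ∣ X ∣ ≡ k * s →
          (a : Subset N) → IsPoint X k s a →
          ((q : Subset N) →
             (Σ (PointSet N) λ B → IsBlock X k s B × B a × B q × q ≢ a)
             ⇔ IsPoint (X ─ a) k (s ∸ 1) q)
          × ((C : PointSet N) →
             (Σ (PointSet N) λ B → IsBlock X k s B × B a
                × ((q : Subset N) → C q ⇔ (B q × q ≢ a)))
             ⇔ IsBlock (X ─ a) k (s ∸ 1) C)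
fact1p1 N (suc k) (suc (suc t)) (s≤s z≤n) (s≤s (s≤s z≤n)) X ∣X∣ a pointA = points , blocks
  where
  excessX : excess X (suc k) (suc (suc t)) ≡ 0
  excessX = excess-zero X (suc k) (suc (suc t)) ∣X∣
  a⊆X×∣a∣ : (a ⊆ X) × (∣ a ∣ ≡ suc k)
  a⊆X×∣a∣ = to (point⇔k-subset {t = suc (suc t)} excessX) pointA
  ∣X─a∣ : ∣ X ─ a ∣ ≡ suc k * suc t
  ∣X─a∣ = size-of-rest (proj₁ a⊆X×∣a∣) (proj₂ a⊆X×∣a∣) ∣X∣
  excessX─a : excess (X ─ a) (suc k) (suc t) ≡ 0
  excessX─a = excess-zero (X ─ a) (suc k) (suc t) ∣X─a∣
  blocks : (C : PointSet N) →
           (Σ (PointSet N) λ B → IsBlock X (suc k) (suc (suc t)) B × B a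
              × ((q : Subset N) → C q ⇔ (B q × q ≢ a)))
           ⇔ IsBlock (X ─ a) (suc k) (suc t) C
  blocks = neighbourhood-blocks excessX excessX─a (proj₁ a⊆X×∣a∣) (proj₂ a⊆X×∣a∣)
  points : (q : Subset N) →
           (Σ (PointSet N) λ B → IsBlock X (suc k) (suc (suc t)) B × B a × B q × q ≢ a)
           ⇔ IsPoint (X ─ a) (suc k) (suc t) q
  points q = ⇔-trans (neighbourhood-points blocks q) (on-block⇔point ∣X─a∣ q)
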